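{- For any Diophantine logic formula $A$ one can compute a list $l$ of elementary Diophantine constraints such that for every valuation $\nu:\mathbb N\to\mathbb N$ of the parameters, $$[\![A]\!]\nu\iff\exists\varphi:\mathbb N\to\mathbb N,\ [\![l]\!]^\varphi_\nu.$$
   Context: Diophantine logic formulas are $A,B::= x_i\doteq n\mid x_i\doteq x_j\mid x_i\doteq x_j\dot+x_k\mid x_i\doteq x_j\dot\times x_k\mid A\dot\wedge B\mid A\dot\vee B\mid\dot\exists A$, where $n\in\mathbb N$ and the variables are De Bruijn indices $i,j,k\in\mathbb N$. For $\nu:\mathbb N\to\mathbb N$, the semantics is as follows. - $[\![x_i\doteq n]\!]\nu\iff\nu(i)=n$ and $[\![x_i\doteq x_j]\!]\nu\iff\nu(i)=\nu(j)$. - $[\![x_i\doteq x_j\dot+x_k]\!]\nu\iff\nu(i)=\nu(j)+\nu(k)$ and $[\![x_i\doteq x_j\dot\times x_k]\!]\nu\iff\nu(i)=\nu(j)\nu(k)$. - $\dot\wedge$ and $\dot\vee$ are interpreted as $\wedge$ and $\vee$. - $[\![\dot\exists A]\!]\nu\iff\exists n,\ [\![A]\!](n\cdot\nu)$, where $(n\cdot\nu)(0)=n$ and $(n\cdot\nu)(i+1)=\nu(i)$. Elementary Diophantine constraints are $u\doteq n$, $u\doteq v$, $u\doteq x_i$, $u\doteq v\dot+w$ and $u\doteq v\dot\times w$, with existential variables $u,v,w\in\mathbb N$, parameters $x_i$ ($i\in\mathbb N$) and $n\in\mathbb N$. Under $\varphi:\mathbb N\to\mathbb N$ (variables) and $\nu:\mathbb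 N\to\mathbb N$ (parameters), their semantics is as follows. - $\varphi(u)=n$, $\varphi(u)=\varphi(v)$ and $\varphi(u)=\nu(i)$ respectively for the first three. - $\varphi(u)=\varphi(v)+\varphi(w)$ and $\varphi(u)=\varphi(v)\varphi(w)$ respectively for the last two. $[\![l]\!]^\varphi_\nu$ means every constraint in $l$ holds. -}

module Defs where

open import Data.Nat using (ℕ; zero; suc; _+_; _*_)
open import Data.Product using (_×_; ∃)
open import Data.Sum using (_⊎_)
open import Data.List using (List)
open import Data.List.Relation.Unary.All using (All)
open import Relation.Binary.PropositionalEquality using (_≡_)

-- Diophantine logic formulas, variables are De Bruijn indices
data DForm : Set where
  var≐cst : ℕ → ℕ → DForm
  var≐var : ℕ → ℕ → DForm
  var≐add : ℕ → ℕ → ℕ → DForm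
  var≐mul : ℕ → ℕ → ℕ → DForm
  _∧̇_     : DForm → DForm → DForm
  _∨̇_     : DForm → DForm → DForm
  ∃̇       : DForm → DForm

_·_ : ℕ → (ℕ → ℕ) → (ℕ → ℕ)
(n · ν) zero    = n
(n · ν) (suc i) = ν i

⟦_⟧ : DForm → (ℕ → ℕ) → Set
⟦ var≐cst i n   ⟧ ν = ν i ≡ n
⟦ var≐var i j   ⟧ ν = ν i ≡ ν j
⟦ var≐add i j k ⟧ ν = ν i ≡ ν j + ν k
⟦ var≐mul i j k ⟧ ν = ν i ≡ ν j * ν k
⟦ A ∧̇ B ⟧ ν = ⟦ A ⟧ ν × ⟦ B ⟧ ν
⟦ A ∨̇ B ⟧ ν = ⟦ A ⟧ ν ⊎ ⟦ B ⟧ ν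
⟦ ∃̇ A ⟧ ν = ∃ λ n → ⟦ A ⟧ (n · ν)

-- Elementary Diophantine constraints: u,v,w existential variables, x_i parameters
data DCstr : Set where
  cst : ℕ → ℕ → DCstr
  eqv : ℕ → ℕ → DCstr
  par : ℕ → ℕ → DCstr
  add : ℕ → ℕ → ℕ → DCstr
  mul : ℕ → ℕ → ℕ → DCstr

⟦_⟧ᶜ : DCstr → (φ ν : ℕ → ℕ) → Set
⟦ cst u n   ⟧ᶜ φ ν = φ u ≡ n
⟦ eqv u v   ⟧ᶜ φ ν = φ u ≡ φ v
⟦ par u i   ⟧ᶜ φ ν = φ u ≡ ν i
⟦ add u v w ⟧ᶜ φ ν = φ u ≡ φ v + φ w
⟦ mul u v w ⟧ᶜ φ ν = φ u ≡ φ v * φ w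

⟦_⟧ˡ : List DCstr → (φ ν : ℕ → ℕ) → Set
⟦ l ⟧ˡ φ ν = All (λ c → ⟦ c ⟧ᶜ φ ν) l

-- Every formula A is compiled into a list l whose variable 0 plays the role of a truth value:
-- l is solvable for every valuation of the parameters, and A holds exactly when some solution
-- gives variable 0 the value 0.  Conjunction adds truth values, disjunction multiplies them
-- (which is why the disjunct that fails must still be solvable), and ∃̇ turns parameter x₀ into
-- a fresh variable.  An atom x ≐ w is tested by t = d + e, x + d = w + e, which is solvable
-- with d = w, e = x and forces x = w when t = 0.  The theorem then adds the constraint t ≐ 0.
module Submission where

open import Defs
open import Data.Nat using (ℕ; zero; suc; _+_; _*_)
open import Data.Nat.Properties
  using (+-comm; +-identityʳ; *-zeroʳ; m+n≡0⇒m≡0; m+n≡0⇒n≡0; m*n≡0⇒m≡0∨n≡0)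
open import Data.Product using (Σ; ∃; ∃₂; _×_; _,_)
open import Data.Sum using (_⊎_; inj₁; inj₂)
open import Data.List using (List; []; _∷_; map; _++_)
open import Data.List.Relation.Unary.All as All using ([]; _∷_)
open import Data.List.Relation.Unary.All.Properties using (map⁺; map⁻; ++⁺; ++⁻)
open import Function using (_∘_; id; const)
open import Function.Bundles using (_⇔_; mk⇔; module Equivalence)
open import Relation.Binary.PropositionalEquality
  using (_≡_; _≗_; refl; sym; trans; cong; cong₂; subst; module ≡-Reasoning)

renameᶜ : (ℕ → ℕ) → DCstr → DCstr
renameᶜ f (cst u n)   = cst (f u) n
renameᶜ f (eqv u v)   = eqv (f u) (f v)
renameᶜ f (par u i)   = par (f u) i
renameᶜ f (add u v w) = add (f u) (f v) (f w)
renameᶜ f (mul u v w) = mul (f u) (f v) (f w)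

instantiate₀ᶜ : (ℕ → ℕ) → ℕ → DCstr → DCstr
instantiate₀ᶜ f w (par u zero)    = eqv (f u) w
instantiate₀ᶜ f w (par u (suc i)) = par (f u) i
instantiate₀ᶜ f w c               = renameᶜ f c

module _ {φ ν : ℕ → ℕ} {f : ℕ → ℕ} where

  ⟦renameᶜ⟧ : ∀ c → ⟦ renameᶜ f c ⟧ᶜ φ ν ≡ ⟦ c ⟧ᶜ (φ ∘ f) ν
  ⟦renameᶜ⟧ (cst u n)   = refl
  ⟦renameᶜ⟧ (eqv u v)   = refl
  ⟦renameᶜ⟧ (par u i)   = refl
  ⟦renameᶜ⟧ (add u v w) = refl
  ⟦renameᶜ⟧ (mul u v w) = refl

  ⟦instantiate₀ᶜ⟧ : ∀ w c → ⟦ instantiate₀ᶜ f w c ⟧ᶜ φ ν ≡ ⟦ c ⟧ᶜ (φ ∘ f) (φ w · ν)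
  ⟦instantiate₀ᶜ⟧ w (cst u n)       = refl
  ⟦instantiate₀ᶜ⟧ w (eqv u v)       = refl
  ⟦instantiate₀ᶜ⟧ w (par u zero)    = refl
  ⟦instantiate₀ᶜ⟧ w (par u (suc i)) = refl
  ⟦instantiate₀ᶜ⟧ w (add u v w′)    = refl
  ⟦instantiate₀ᶜ⟧ w (mul u v w′)    = refl

⟦map⟧ˡ : ∀ {g : DCstr → DCstr} {φ ν ψ μ} → (∀ c → ⟦ g c ⟧ᶜ φ ν ≡ ⟦ c ⟧ᶜ ψ μ) →
         ∀ l → ⟦ map g l ⟧ˡ φ ν ⇔ ⟦ l ⟧ˡ ψ μ
⟦map⟧ˡ sem l = mk⇔ (All.map (λ {c} → subst id (sem c)) ∘ map⁻)
                   (map⁺ ∘ All.map (λ {c} → subst id (sym (sem c))))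

⟦⟧ᶜ-cong : ∀ {φ ψ ν} → φ ≗ ψ → ∀ c → ⟦ c ⟧ᶜ φ ν → ⟦ c ⟧ᶜ ψ ν
⟦⟧ᶜ-cong φ≗ψ (cst u n)   p = trans (sym (φ≗ψ u)) p
⟦⟧ᶜ-cong φ≗ψ (eqv u v)   p = trans (sym (φ≗ψ u)) (trans p (φ≗ψ v))
⟦⟧ᶜ-cong φ≗ψ (par u i)   p = trans (sym (φ≗ψ u)) p
⟦⟧ᶜ-cong φ≗ψ (add u v w) p = trans (sym (φ≗ψ u)) (trans p (cong₂ _+_ (φ≗ψ v) (φ≗ψ w)))
⟦⟧ᶜ-cong φ≗ψ (mul u v w) p = trans (sym (φ≗ψ u)) (trans p (cong₂ _*_ (φ≗ψ v) (φ≗ψ w)))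

⟦⟧ˡ-cong : ∀ {φ ψ ν} → φ ≗ ψ → ∀ {l} → ⟦ l ⟧ˡ φ ν → ⟦ l ⟧ˡ ψ ν
⟦⟧ˡ-cong φ≗ψ = All.map (λ {c} → ⟦⟧ᶜ-cong φ≗ψ c)

double : ℕ → ℕ
double zero    = zero
double (suc n) = suc (suc (double n))

interleave : (ℕ → ℕ) → (ℕ → ℕ) → ℕ → ℕ
interleave g h zero    = g 0
interleave g h (suc n) = interleave h (g ∘ suc) n

interleave-double : ∀ g h → interleave g h ∘ double ≗ g
interleave-double g h zero    = refl
interleave-double g h (suc n) = interleave-double (g ∘ suc) (h ∘ suc) n

Attains : List DCstr → (ℕ → ℕ) → ℕ → Set
Attains l ν t = ∃ λ φ → ⟦ cst 0 t ∷ l ⟧ˡ φ ν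

record Represents (P : (ℕ → ℕ) → Set) (l : List DCstr) : Set where
  field
    correct : ∀ ν → P ν ⇔ Attains l ν 0
    total   : ∀ ν → ∃ (Attains l ν)
open Represents

left right : ℕ → ℕ
left  = suc ∘ double
right = suc ∘ suc ∘ double

join : List DCstr → List DCstr → List DCstr
join lA lB = map (renameᶜ left) lA ++ map (renameᶜ right) lB

module _ {lA lB : List DCstr} {ν : ℕ → ℕ} where

  join-split : ∀ {φ} → ⟦ join lA lB ⟧ˡ φ ν → ⟦ lA ⟧ˡ (φ ∘ left) ν × ⟦ lB ⟧ˡ (φ ∘ right) ν
  join-split h with ++⁻ (map (renameᶜ left) lA) h
  ... | hA , hB = Equivalence.to (⟦map⟧ˡ ⟦renameᶜ⟧ lA) hA ,
                  Equivalence.to (⟦map⟧ˡ ⟦renameᶜ⟧ lB) hB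

  join-merge : ∀ {φ₁ φ₂} t → ⟦ lA ⟧ˡ φ₁ ν → ⟦ lB ⟧ˡ φ₂ ν →
               ⟦ join lA lB ⟧ˡ (t · interleave φ₁ φ₂) ν
  join-merge {φ₁} {φ₂} t hA hB = ++⁺
    (Equivalence.from (⟦map⟧ˡ ⟦renameᶜ⟧ lA) (⟦⟧ˡ-cong (sym ∘ interleave-double φ₁ φ₂) hA))
    (Equivalence.from (⟦map⟧ˡ ⟦renameᶜ⟧ lB) (⟦⟧ˡ-cong (sym ∘ interleave-double φ₂ (φ₁ ∘ suc)) hB))

module Gate (gate : ℕ → ℕ → ℕ → DCstr) (_⊕_ : ℕ → ℕ → ℕ)
            (⟦gate⟧ : ∀ {φ ν} → ⟦ gate 0 1 2 ⟧ᶜ φ ν ≡ (φ 0 ≡ φ 1 ⊕ φ 2)) where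

  gated : List DCstr → List DCstr → List DCstr
  gated lA lB = gate 0 1 2 ∷ join lA lB

  Splits : List DCstr → List DCstr → (ℕ → ℕ) → ℕ → Set
  Splits lA lB ν t = ∃₂ λ a b → Attains lA ν a × Attains lB ν b × t ≡ a ⊕ b

  attains-gated : ∀ {lA lB ν t} → Attains (gated lA lB) ν t ⇔ Splits lA lB ν t
  attains-gated {lA} {lB} = mk⇔ to from
    where
    to : ∀ {ν t} → Attains (gated lA lB) ν t → Splits lA lB ν t
    to (φ , φ0≡t ∷ g ∷ h) with join-split {lA} {lB} h
    ... | hA , hB = φ 1 , φ 2 , (φ ∘ left , refl ∷ hA) , (φ ∘ right , refl ∷ hB) ,
                    trans (sym φ0≡t) (subst id ⟦gate⟧ g)
    from : ∀ {ν t} → Splits lA lB ν t → Attains (gated lA lB) ν t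
    from {t = t} (a , b , (φ₁ , e₁ ∷ hA) , (φ₂ , e₂ ∷ hB) , t≡a⊕b) =
      t · interleave φ₁ φ₂ ,
      refl ∷ subst id (sym ⟦gate⟧) (trans t≡a⊕b (sym (cong₂ _⊕_ e₁ e₂))) ∷ join-merge t hA hB

module Sum     = Gate add _+_ refl
module Product = Gate mul _*_ refl

∧-represents : ∀ {P Q lA lB} → Represents P lA → Represents Q lB →
               Represents (λ ν → P ν × Q ν) (Sum.gated lA lB)
∧-represents {P} {Q} {lA} {lB} RA RB =
  record { correct = λ ν → mk⇔ (complete ν) (sound ν) ; total = tot }
  where
  open Equivalence
  complete : ∀ ν → P ν × Q ν → Attains (Sum.gated lA lB) ν 0
  complete ν (p , q) =
    from Sum.attains-gated (0 , 0 , to (correct RA ν) p , to (correct RB ν) q , refl)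
  sound : ∀ ν → Attains (Sum.gated lA lB) ν 0 → P ν × Q ν
  sound ν h with to Sum.attains-gated h
  ... | a , b , hA , hB , 0≡a+b =
    from (correct RA ν) (subst (Attains lA ν) (m+n≡0⇒m≡0 a (sym 0≡a+b)) hA) ,
    from (correct RB ν) (subst (Attains lB ν) (m+n≡0⇒n≡0 a (sym 0≡a+b)) hB)
  tot : ∀ ν → ∃ (Attains (Sum.gated lA lB) ν)
  tot ν with total RA ν | total RB ν
  ... | a , hA | b , hB = a + b , from Sum.attains-gated (a , b , hA , hB , refl)

∨-represents : ∀ {P Q lA lB} → Represents P lA → Represents Q lB →
               Represents (λ ν → P ν ⊎ Q ν) (Product.gated lA lB)
∨-represents {P} {Q} {lA} {lB} RA RB =
  record { correct = λ ν → mk⇔ (complete ν) (sound ν) ; total = tot }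
  where
  open Equivalence
  complete : ∀ ν → P ν ⊎ Q ν → Attains (Product.gated lA lB) ν 0
  complete ν (inj₁ p) with total RB ν
  ... | b , hB = from Product.attains-gated (0 , b , to (correct RA ν) p , hB , refl)
  complete ν (inj₂ q) with total RA ν
  ... | a , hA = from Product.attains-gated (a , 0 , hA , to (correct RB ν) q , sym (*-zeroʳ a))
  sound : ∀ ν → Attains (Product.gated lA lB) ν 0 → P ν ⊎ Q ν
  sound ν h with to Product.attains-gated h
  ... | a , b , hA , hB , 0≡a*b with m*n≡0⇒m≡0∨n≡0 a (sym 0≡a*b)
  ...   | inj₁ a≡0 = inj₁ (from (correct RA ν) (subst (Attains lA ν) a≡0 hA))
  ...   | inj₂ b≡0 = inj₂ (from (correct RB ν) (subst (Attains lB ν) b≡0 hB))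
  tot : ∀ ν → ∃ (Attains (Product.gated lA lB) ν)
  tot ν with total RA ν | total RB ν
  ... | a , hA | b , hB = a * b , from Product.attains-gated (a , b , hA , hB , refl)

-- Variable 1 holds the witness, the variables of l are moved to 2, 3, ...
quantified : List DCstr → List DCstr
quantified l = eqv 0 2 ∷ map (instantiate₀ᶜ (2 +_) 1) l

attains-quantified : ∀ {l ν t} → Attains (quantified l) ν t ⇔ ∃ λ n → Attains l (n · ν) t
attains-quantified {l} {ν} {t} = mk⇔
  (λ { (φ , φ0≡t ∷ φ0≡φ2 ∷ h) → φ 1 , φ ∘ (2 +_) , trans (sym φ0≡φ2) φ0≡t ∷ to ⟦l⟧ h })
  (λ { (n , φ , φ0≡t ∷ h) → t · (n · φ) , refl ∷ sym φ0≡t ∷ from ⟦l⟧ h })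
  where
  open Equivalence
  ⟦l⟧ : ∀ {φ} → ⟦ map (instantiate₀ᶜ (2 +_) 1) l ⟧ˡ φ ν ⇔ ⟦ l ⟧ˡ (φ ∘ (2 +_)) (φ 1 · ν)
  ⟦l⟧ = ⟦map⟧ˡ (⟦instantiate₀ᶜ⟧ 1) l

∃-represents : ∀ {P l} → Represents P l → Represents (λ ν → ∃ λ n → P (n · ν)) (quantified l)
∃-represents R = record
  { correct = λ ν → mk⇔
      (λ { (n , p) → from attains-quantified (n , to (correct R (n · ν)) p) })
      (λ h → let (n , hA) = to attains-quantified h in n , from (correct R (n · ν)) hA)
  ; total = λ ν → let (t , h) = total R (0 · ν) in t , from attains-quantified (0 , h)
  }
  where open Equivalence

-- Variables 0 to 3 are t, d, e, s; variables 0 and 1 of l (the sides x and w) sit at 4 and 5.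
equation : List DCstr → List DCstr
equation l = add 0 1 2 ∷ add 3 4 1 ∷ add 3 5 2 ∷ map (renameᶜ (4 +_)) l

+-cancel-zeros : ∀ x w {d e} → x + d ≡ w + e → d + e ≡ 0 → x ≡ w
+-cancel-zeros x w {d} {e} x+d≡w+e d+e≡0 = begin
  x      ≡⟨ +-identityʳ x ⟨
  x + 0  ≡⟨ cong (x +_) (m+n≡0⇒m≡0 d d+e≡0) ⟨
  x + d  ≡⟨ x+d≡w+e ⟩
  w + e  ≡⟨ cong (w +_) (m+n≡0⇒n≡0 d d+e≡0) ⟩
  w + 0  ≡⟨ +-identityʳ w ⟩
  w      ∎
  where open ≡-Reasoning

equation-represents : ∀ {l} {a b : (ℕ → ℕ) → ℕ} →
                      (∀ {ψ ν} → ⟦ l ⟧ˡ ψ ν → ψ 0 ≡ a ν × ψ 1 ≡ b ν) →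
                      (∀ ν → ∃ λ ψ → ⟦ l ⟧ˡ ψ ν) →
                      Represents (λ ν → a ν ≡ b ν) (equation l)
equation-represents {l} {a} {b} determined solvable =
  record { correct = λ ν → mk⇔ (complete ν) sound ; total = tot }
  where
  shifted : ∀ {ψ ν} t d e s → ⟦ l ⟧ˡ ψ ν →
            ⟦ map (renameᶜ (4 +_)) l ⟧ˡ (t · (d · (e · (s · ψ)))) ν
  shifted t d e s = Equivalence.from (⟦map⟧ˡ ⟦renameᶜ⟧ l)
  complete : ∀ ν → a ν ≡ b ν → Attains (equation l) ν 0
  complete ν a≡b with solvable ν
  ... | ψ , h with determined h
  ...   | ψ0≡a , ψ1≡b = 0 · (0 · (0 · (ψ 0 · ψ))) ,
                        refl ∷ refl ∷ sym (+-identityʳ (ψ 0)) ∷ ψ0≡ψ1+0 ∷ shifted 0 0 0 (ψ 0) h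
    where
    ψ0≡ψ1+0 : ψ 0 ≡ ψ 1 + 0
    ψ0≡ψ1+0 = trans ψ0≡a (trans a≡b (trans (sym ψ1≡b) (sym (+-identityʳ (ψ 1)))))
  sound : ∀ {ν} → Attains (equation l) ν 0 → a ν ≡ b ν
  sound (φ , φ0≡0 ∷ φ0≡d+e ∷ s≡x+d ∷ s≡w+e ∷ h)
    with determined (Equivalence.to (⟦map⟧ˡ ⟦renameᶜ⟧ l) h)
  ... | x≡a , w≡b = trans (sym x≡a) (trans x≡w w≡b)
    where
    x≡w : φ 4 ≡ φ 5
    x≡w = +-cancel-zeros (φ 4) (φ 5) (trans (sym s≡x+d) s≡w+e) (trans (sym φ0≡d+e) φ0≡0)
  tot : ∀ ν → ∃ (Attains (equation l) ν)
  tot ν with solvable ν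
  ... | ψ , h = t , t · (ψ 1 · (ψ 0 · ((ψ 0 + ψ 1) · ψ))) ,
                refl ∷ refl ∷ refl ∷ +-comm (ψ 0) (ψ 1) ∷ shifted t (ψ 1) (ψ 0) (ψ 0 + ψ 1) h
    where t = ψ 1 + ψ 0

compile : DForm → List DCstr
compile (var≐cst i n)   = equation (par 0 i ∷ cst 1 n ∷ [])
compile (var≐var i j)   = equation (par 0 i ∷ par 1 j ∷ [])
compile (var≐add i j k) = equation (par 0 i ∷ par 2 j ∷ par 3 k ∷ add 1 2 3 ∷ [])
compile (var≐mul i j k) = equation (par 0 i ∷ par 2 j ∷ par 3 k ∷ mul 1 2 3 ∷ [])
compile (A ∧̇ B)         = Sum.gated (compile A) (compile B)
compile (A ∨̇ B)         = Product.gated (compile A) (compile B)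
compile (∃̇ A)           = quantified (compile A)

compile-represents : ∀ A → Represents ⟦ A ⟧ (compile A)
compile-represents (var≐cst i n) =
  equation-represents (λ { (x ∷ w ∷ []) → x , w }) (λ ν → ν i · (n · const 0) , refl ∷ refl ∷ [])
compile-represents (var≐var i j) =
  equation-represents (λ { (x ∷ w ∷ []) → x , w }) (λ ν → ν i · (ν j · const 0) , refl ∷ refl ∷ [])
compile-represents (var≐add i j k) =
  equation-represents (λ { (x ∷ y ∷ z ∷ w ∷ []) → x , trans w (cong₂ _+_ y z) })
                      (λ ν → ν i · ((ν j + ν k) · (ν j · (ν k · const 0))) ,
                             refl ∷ refl ∷ refl ∷ refl ∷ [])
compile-represents (var≐mul i j k) =
  equation-represents (λ { (x ∷ y ∷ z ∷ w ∷ []) → x , trans w (cong₂ _*_ y z) })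
                      (λ ν → ν i · ((ν j * ν k) · (ν j · (ν k · const 0))) ,
                             refl ∷ refl ∷ refl ∷ refl ∷ [])
compile-represents (A ∧̇ B) = ∧-represents (compile-represents A) (compile-represents B)
compile-represents (A ∨̇ B) = ∨-represents (compile-represents A) (compile-represents B)
compile-represents (∃̇ A)   = ∃-represents (compile-represents A)

theorem3p1 : (A : DForm) → Σ (List DCstr) λ l →
    (ν : ℕ → ℕ) → (⟦ A ⟧ ν ⇔ ∃ λ (φ : ℕ → ℕ) → ⟦ l ⟧ˡ φ ν)
theorem3p1 A = cst 0 0 ∷ compile A , correct (compile-represents A)
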